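{- Let $n\geq2$, let $Z$ be a closed subset of $\mathbb{P}^n(\mathbb{R})$ and let $Z'\subseteq Z(\mathbb{Q})$ be non-empty. Let $H$ be a proper projective subspace of $\mathbb{P}^n(\mathbb{R})$ defined over $\mathbb{Q}$ and let $s_H:Z'\to\mathbb{N}$ be a function such that for each $x\in Z'$: (i) if $s_H(x)=0$ then $x\notin H$; (ii) if $s_H(x)\geq1$ then there exists a projective line $L$ defined over $\mathbb{Q}$ with $x\in L(\mathbb{Q})\subseteq Z'$ and $\#\{y\in L(\mathbb{Q})\,;\,s_H(y)\geq s_H(x)\}<\infty$. Then for any nonzero integer point $\mathbf{x}\in\mathbb{Z}^{n+1}$ with $[\mathbf{x}]\in Z'\cap H$ we have $s_H([\mathbf{x}])\geq1$, and there exist a constant $C=C(\mathbf{x},H)>0$ and infinitely many nonzero integer points $\mathbf{y}\in\mathbb{Z}^{n+1}$ with $[\mathbf{y}]\in Z'$ satisfying $\mathrm{dist}(\mathbf{x},\mathbf{y})\leq C/\|\mathbf{y}\|$ and $s_H([\mathbf{y}])<s_H([\mathbf{x}])$.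
   Context: $\mathbb{N}=\{0,1,2,\dots\}$. $Z(\mathbb{Q})=Z\cap\mathbb{P}^n(\mathbb{Q})$ and $L(\mathbb{Q})=L\cap\mathbb{P}^n(\mathbb{Q})$. For nonzero $\mathbf{x}\in\mathbb{R}^{n+1}$, $[\mathbf{x}]$ is its class in $\mathbb{P}^n(\mathbb{R})$. For nonzero $\mathbf{x},\mathbf{y}\in\mathbb{R}^{n+1}$, $\mathrm{dist}(\mathbf{x},\mathbf{y})=\|\mathbf{x}\wedge\mathbf{y}\|/(\|\mathbf{x}\|\,\|\mathbf{y}\|)$, where $\|\cdot\|$ is the Euclidean norm. The constant $C$ depends only on $\mathbf{x}$ and $H$, not on $\mathbf{y}$. -}

module Defs where

open import Data.Nat using (ℕ; zero; suc; _≤_)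
open import Data.Integer as ℤ using (ℤ; 0ℤ; _+_; _-_; _*_)
open import Data.Rational as ℚ using (ℚ; _/_)
open import Data.Vec using (Vec; []; _∷_; replicate; zipWith; map)
open import Data.Product using (Σ; ∃; _×_; _,_)
open import Relation.Nullary using (¬_)
open import Relation.Binary.PropositionalEquality using (_≡_)

Pt : ℕ → Set
Pt n = Vec ℤ (suc n)

NonZeroV : ∀ {m} → Vec ℤ m → Set
NonZeroV {m} x = ¬ (x ≡ replicate m 0ℤ)

_·_ : ∀ {m} → ℤ → Vec ℤ m → Vec ℤ m
c · x = map (c *_) x

_⊕_ : ∀ {m} → Vec ℤ m → Vec ℤ m → Vec ℤ m
_⊕_ = zipWith _+_

linComb : ∀ {k m} → Vec ℤ k → Vec (Vec ℤ m) k → Vec ℤ m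
linComb {m = m} [] [] = replicate m 0ℤ
linComb (c ∷ cs) (g ∷ gs) = (c · g) ⊕ linComb cs gs

-- y lies in the ℚ-span of the vectors gs  (d·y = Σ c_i g_i with d ≠ 0)
InSpan : ∀ {k m} → Vec (Vec ℤ m) k → Vec ℤ m → Set
InSpan {k} gs y = Σ ℤ λ d → ¬ (d ≡ 0ℤ) × Σ (Vec ℤ k) λ c → d · y ≡ linComb c gs

SamePt : ∀ {m} → Vec ℤ m → Vec ℤ m → Set
SamePt x y = Σ ℤ λ a → Σ ℤ λ b → ¬ (a ≡ 0ℤ) × ¬ (b ≡ 0ℤ) × a · x ≡ b · y

normSq : ∀ {m} → Vec ℤ m → ℤ
normSq [] = 0ℤ
normSq (x ∷ xs) = x * x + normSq xs

private
  rowSq : ∀ {m} → ℤ → ℤ → Vec ℤ m → Vec ℤ m → ℤ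
  rowSq a b [] [] = 0ℤ
  rowSq a b (x ∷ xs) (y ∷ ys) = (a * y - x * b) * (a * y - x * b) + rowSq a b xs ys

wedgeSq : ∀ {m} → Vec ℤ m → Vec ℤ m → ℤ
wedgeSq [] [] = 0ℤ
wedgeSq (x ∷ xs) (y ∷ ys) = rowSq x y xs ys + wedgeSq xs ys

ℤtoℚ : ℤ → ℚ
ℤtoℚ z = z / 1

-- DistLe C x y  encodes  dist(x,y) ≤ C / ‖y‖  for nonzero x, y and C > 0:
--   ‖x∧y‖/(‖x‖‖y‖) ≤ C/‖y‖  ⇔  ‖x∧y‖² ≤ C² ‖x‖²   (both sides ≥ 0, ‖y‖ > 0)
DistLe : ∀ {m} → ℚ → Vec ℤ m → Vec ℤ m → Set
DistLe C x y = ℚ._≤_ (ℤtoℚ (wedgeSq x y)) (ℚ._*_ (ℚ._*_ C C) (ℤtoℚ (normSq x)))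

-- A projective line defined over ℚ: spanned by two non-proportional nonzero
-- integer vectors a, b; its rational points are the nonzero y in span(a,b).
IsLine : ∀ {m} → Vec ℤ m → Vec ℤ m → Set
IsLine a b = NonZeroV a × NonZeroV b × ¬ SamePt a b

OnLine : ∀ {m} → Vec ℤ m → Vec ℤ m → Vec ℤ m → Set
OnLine a b y = NonZeroV y × InSpan (a ∷ b ∷ []) y

{-# OPTIONS --safe #-}
-- By (i), x ∈ H forces s(x) ≥ 1, so (ii) gives a rational line L = ⟨a, b⟩ through x, say
-- d x = c a + c′ b. One of a, b, call it e, is not proportional to x. The points t x + e (t ∈ ℕ)
-- lie on L, are pairwise distinct in projective space, and ‖x ∧ (t x + e)‖ = ‖x ∧ e‖ does not
-- depend on t, which is exactly dist(x, t x + e) ≤ C / ‖t x + e‖. Only finitely many points of L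
-- have s ≥ s(x), so all but finitely many of these points have s < s(x).
module Submission where

open import Defs
open import Data.Nat as ℕ using (ℕ; suc; zero; _≤_; _<_; s≤s; z≤n)
open import Data.Integer as ℤ using (ℤ; 0ℤ; 1ℤ; +_; +[1+_]; -[1+_]; _+_; _*_; _-_)
import Data.Integer.Properties as ℤ
import Data.Nat.Properties as ℕ
open import Data.Rational as ℚ using (ℚ; mkℚ)
import Data.Rational.Properties as ℚ
open import Data.Nat.Coprimality as Coprime using (Coprime; 1-coprimeTo)
open import Data.Integer.Tactic.RingSolver using (solve-∀)
open import Algebra.Properties.AbelianGroup ℤ.+-0-abelianGroup using (∙-cancelʳ)
open import Data.Vec using (Vec; []; _∷_; replicate; lookup)
open import Data.Fin using (zero; suc)
open import Data.Vec.Properties using (∷-injective; lookup-map; ≡-dec)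
open import Data.List using (List; []; _∷_; _++_)
open import Data.List.Membership.Propositional using (_∈_; _∉_)
open import Data.List.Relation.Unary.All as All using (All; []; _∷_)
open import Data.List.Relation.Unary.All.Properties using (++⁻)
open import Data.Product using (Σ; ∃; _×_; _,_; proj₁; proj₂)
open import Data.Sum using (inj₁; inj₂)
open import Data.Empty using (⊥-elim)
open import Relation.Nullary using (¬_; Dec; yes; no)
open import Relation.Binary.PropositionalEquality

private
  variable
    m : ℕ

*≡0⇒≡0 : ∀ {i j} → ¬ j ≡ 0ℤ → i * j ≡ 0ℤ → i ≡ 0ℤ
*≡0⇒≡0 {i} j≢0 ij≡0 with ℤ.i*j≡0⇒i≡0∨j≡0 i ij≡0
... | inj₁ i≡0 = i≡0
... | inj₂ j≡0 = ⊥-elim (j≢0 j≡0)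

0v : ∀ m → Vec ℤ m
0v m = replicate m 0ℤ

·-assoc : ∀ a b (x : Vec ℤ m) → a · (b · x) ≡ (a * b) · x
·-assoc a b []       = refl
·-assoc a b (x ∷ xs) = cong₂ _∷_ (sym (ℤ.*-assoc a b x)) (·-assoc a b xs)

·-identityˡ : (x : Vec ℤ m) → 1ℤ · x ≡ x
·-identityˡ []       = refl
·-identityˡ (x ∷ xs) = cong₂ _∷_ (ℤ.*-identityˡ x) (·-identityˡ xs)

·-zeroˡ : (x : Vec ℤ m) → 0ℤ · x ≡ 0v m
·-zeroˡ []       = refl
·-zeroˡ (x ∷ xs) = cong (0ℤ ∷_) (·-zeroˡ xs)

·-distribˡ-⊕ : ∀ c (x y : Vec ℤ m) → c · (x ⊕ y) ≡ (c · x) ⊕ (c · y)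
·-distribˡ-⊕ c []       []       = refl
·-distribˡ-⊕ c (x ∷ xs) (y ∷ ys) = cong₂ _∷_ (ℤ.*-distribˡ-+ c x y) (·-distribˡ-⊕ c xs ys)

⊕-identityʳ : (x : Vec ℤ m) → x ⊕ 0v m ≡ x
⊕-identityʳ []       = refl
⊕-identityʳ (x ∷ xs) = cong₂ _∷_ (ℤ.+-identityʳ x) (⊕-identityʳ xs)

·-⊕-zero : (x y : Vec ℤ m) → (0ℤ · x) ⊕ (0ℤ · y) ≡ 0v m
·-⊕-zero x y = trans (cong₂ _⊕_ (·-zeroˡ x) (·-zeroˡ y)) (⊕-identityʳ (0v _))

linComb-zeros : ∀ {k} (gs : Vec (Vec ℤ m) k) → linComb (replicate k 0ℤ) gs ≡ 0v m
linComb-zeros []       = refl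
linComb-zeros (g ∷ gs) = trans (cong₂ _⊕_ (·-zeroˡ g) (linComb-zeros gs)) (⊕-identityʳ (0v _))

linComb₂ : ∀ r s (u v : Vec ℤ m) → linComb (r ∷ s ∷ []) (u ∷ v ∷ []) ≡ (r · u) ⊕ (s · v)
linComb₂ r s u v = cong ((r · u) ⊕_) (⊕-identityʳ (s · v))

linComb₂-comm : ∀ r s (u v : Vec ℤ m) →
  linComb (r ∷ s ∷ []) (u ∷ v ∷ []) ≡ linComb (s ∷ r ∷ []) (v ∷ u ∷ [])
linComb₂-comm r s []       []       = refl
linComb₂-comm r s (u ∷ us) (v ∷ vs) = cong₂ _∷_ (swap r s u v) (linComb₂-comm r s us vs)
  where
  swap : ∀ r s u v → r * u + (s * v + 0ℤ) ≡ s * v + (r * u + 0ℤ)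
  swap = solve-∀

·-cancel-0v : ∀ {c} {x : Vec ℤ m} → ¬ c ≡ 0ℤ → c · x ≡ 0v m → x ≡ 0v m
·-cancel-0v {x = []}     c≢0 eq = refl
·-cancel-0v {x = x ∷ xs} c≢0 eq with ∷-injective eq
... | cx≡0 , eq′ with ℤ.i*j≡0⇒i≡0∨j≡0 _ cx≡0
...   | inj₁ c≡0 = ⊥-elim (c≢0 c≡0)
...   | inj₂ x≡0 = cong₂ _∷_ x≡0 (·-cancel-0v c≢0 eq′)

·-lookup : ∀ α β {y g : Vec ℤ m} → α · y ≡ β · g → ∀ i → α * lookup y i ≡ β * lookup g i
·-lookup α β {y} {g} eq i =
  trans (sym (lookup-map i (α *_) y)) (trans (cong (λ v → lookup v i) eq) (lookup-map i (β *_) g))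

·-cross : ∀ α β p q (y g : Vec ℤ m) → ¬ α ≡ 0ℤ → α * p ≡ β * q → α · y ≡ β · g → q · y ≡ p · g
·-cross α β p q []       []       _   _  _  = refl
·-cross α β p q (y ∷ ys) (g ∷ gs) α≢0 αp≡βq eq with ∷-injective eq
... | αy≡βg , eq′ = cong₂ _∷_ (ℤ.*-cancelˡ-≡ α (q * y) (p * g) {{ℤ.≢-nonZero α≢0}} component)
                              (·-cross α β p q ys gs α≢0 αp≡βq eq′)
  where
  open ≡-Reasoning
  swap : ∀ α q y → α * (q * y) ≡ q * (α * y)
  swap = solve-∀
  reassoc : ∀ q β g → q * (β * g) ≡ (β * q) * g
  reassoc = solve-∀
  component : α * (q * y) ≡ α * (p * g)
  component = begin
    α * (q * y)  ≡⟨ swap α q y ⟩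
    q * (α * y)  ≡⟨ cong (q *_) αy≡βg ⟩
    q * (β * g)  ≡⟨ reassoc q β g ⟩
    (β * q) * g  ≡⟨ cong (_* g) (sym αp≡βq) ⟩
    (α * p) * g  ≡⟨ ℤ.*-assoc α p g ⟩
    α * (p * g)  ∎

samePt-refl : (x : Vec ℤ m) → SamePt x x
samePt-refl x = 1ℤ , 1ℤ , (λ ()) , (λ ()) , refl

samePt-sym : {x y : Vec ℤ m} → SamePt x y → SamePt y x
samePt-sym (α , β , α≢0 , β≢0 , eq) = β , α , β≢0 , α≢0 , sym eq

samePt-trans : {x y z : Vec ℤ m} → SamePt x y → SamePt y z → SamePt x z
samePt-trans {x = x} {y} {z} (α , β , α≢0 , β≢0 , αx≡βy) (γ , δ , γ≢0 , δ≢0 , γy≡δz) =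
  γ * α , β * δ , nonzero-* γ≢0 α≢0 , nonzero-* β≢0 δ≢0 , (begin
    (γ * α) · x  ≡⟨ sym (·-assoc γ α x) ⟩
    γ · (α · x)  ≡⟨ cong (γ ·_) αx≡βy ⟩
    γ · (β · y)  ≡⟨ ·-assoc γ β y ⟩
    (γ * β) · y  ≡⟨ cong (_· y) (ℤ.*-comm γ β) ⟩
    (β * γ) · y  ≡⟨ sym (·-assoc β γ y) ⟩
    β · (γ · y)  ≡⟨ cong (β ·_) γy≡δz ⟩
    β · (δ · z)  ≡⟨ ·-assoc β δ z ⟩
    (β * δ) · z  ∎)
  where
  open ≡-Reasoning
  nonzero-* : ∀ {i j} → ¬ i ≡ 0ℤ → ¬ j ≡ 0ℤ → ¬ i * j ≡ 0ℤ
  nonzero-* i≢0 j≢0 ij≡0 = i≢0 (*≡0⇒≡0 j≢0 ij≡0)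

nonzero-entry : (y : Vec ℤ m) → NonZeroV y → ∃ λ i → ¬ lookup y i ≡ 0ℤ
nonzero-entry []       y≢0 = ⊥-elim (y≢0 refl)
nonzero-entry (y ∷ ys) y≢0 with y ℤ.≟ 0ℤ
... | no y₀≢0 = zero , y₀≢0
... | yes refl with nonzero-entry ys (λ ys≡0 → y≢0 (cong (0ℤ ∷_) ys≡0))
...   | i , yᵢ≢0 = suc i , yᵢ≢0

-- With yᵢ ≠ 0 a pivot entry of y: [y] = [g] iff gᵢ ≠ 0 and gᵢ · y = yᵢ · g.
samePt? : (y g : Vec ℤ m) → NonZeroV y → Dec (SamePt y g)
samePt? y g y≢0 with nonzero-entry y y≢0
... | i , yᵢ≢0 with lookup g i ℤ.≟ 0ℤ
...   | yes gᵢ≡0 = no λ (α , β , α≢0 , _ , αy≡βg) →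
          α≢0 (*≡0⇒≡0 yᵢ≢0 (trans (·-lookup α β αy≡βg i) (trans (cong (β *_) gᵢ≡0) (ℤ.*-zeroʳ β))))
...   | no gᵢ≢0 with ≡-dec ℤ._≟_ (lookup g i · y) (lookup y i · g)
...     | yes eq = yes (lookup g i , lookup y i , gᵢ≢0 , yᵢ≢0 , eq)
...     | no ¬eq = no λ (α , β , α≢0 , _ , αy≡βg) → ¬eq (·-cross α β _ _ y g α≢0 (·-lookup α β αy≡βg i) αy≡βg)

Independent : Vec ℤ m → Vec ℤ m → Set
Independent u v = ∀ r s → r · u ≡ s · v → r ≡ 0ℤ × s ≡ 0ℤ

isLine⇒independent : {a b : Vec ℤ m} → IsLine a b → Independent a b
isLine⇒independent {a = a} {b} (a≢0 , b≢0 , a≁b) r s eq with r ℤ.≟ 0ℤ | s ℤ.≟ 0ℤ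
... | yes r≡0  | yes s≡0 = r≡0 , s≡0
... | yes refl | no s≢0  = ⊥-elim (b≢0 (·-cancel-0v s≢0 (trans (sym eq) (·-zeroˡ a))))
... | no r≢0   | yes refl = ⊥-elim (a≢0 (·-cancel-0v r≢0 (trans eq (·-zeroˡ b))))
... | no r≢0   | no s≢0  = ⊥-elim (a≁b (r , s , r≢0 , s≢0 , eq))

coords-diff : ∀ r s r′ s′ (u v : Vec ℤ m) →
  (r · u) ⊕ (s · v) ≡ (r′ · u) ⊕ (s′ · v) → (r - r′) · u ≡ (s′ - s) · v
coords-diff r s r′ s′ []       []       _  = refl
coords-diff r s r′ s′ (u ∷ us) (v ∷ vs) eq with ∷-injective eq
... | eqᵢ , eq′ = cong₂ _∷_ component (coords-diff r s r′ s′ us vs eq′)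
  where
  open ≡-Reasoning
  expand : ∀ r s r′ u v → (r - r′) * u ≡ (r * u + s * v) - (r′ * u + s * v)
  expand = solve-∀
  collect : ∀ s r′ s′ u v → (r′ * u + s′ * v) - (r′ * u + s * v) ≡ (s′ - s) * v
  collect = solve-∀
  component : (r - r′) * u ≡ (s′ - s) * v
  component = begin
    (r - r′) * u                        ≡⟨ expand r s r′ u v ⟩
    (r * u + s * v) - (r′ * u + s * v)  ≡⟨ cong (_- (r′ * u + s * v)) eqᵢ ⟩
    (r′ * u + s′ * v) - (r′ * u + s * v) ≡⟨ collect s r′ s′ u v ⟩
    (s′ - s) * v                        ∎

independent-coords : {u v : Vec ℤ m} → Independent u v → ∀ r s r′ s′ →
  (r · u) ⊕ (s · v) ≡ (r′ · u) ⊕ (s′ · v) → r ≡ r′ × s ≡ s′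
independent-coords {u = u} {v} u⊥v r s r′ s′ eq
  with u⊥v (r - r′) (s′ - s) (coords-diff r s r′ s′ u v eq)
... | r-r′≡0 , s′-s≡0 = ℤ.i-j≡0⇒i≡j r r′ r-r′≡0 , sym (ℤ.i-j≡0⇒i≡j s′ s s′-s≡0)

independent-of-span₂ : ∀ {d c c′} {a b x : Vec ℤ m} → Independent a b → ¬ d ≡ 0ℤ → ¬ c′ ≡ 0ℤ →
  d · x ≡ linComb (c ∷ c′ ∷ []) (a ∷ b ∷ []) → Independent x a
independent-of-span₂ {d = d} {c} {c′} {a} {b} {x} a⊥b d≢0 c′≢0 dx r s rx≡sa = r≡0 , s≡0
  where
  open ≡-Reasoning
  coords : ((r * c) · a) ⊕ ((r * c′) · b) ≡ ((d * s) · a) ⊕ (0ℤ · b)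
  coords = begin
    ((r * c) · a) ⊕ ((r * c′) · b)  ≡⟨ sym (cong₂ _⊕_ (·-assoc r c a) (·-assoc r c′ b)) ⟩
    (r · (c · a)) ⊕ (r · (c′ · b))  ≡⟨ sym (·-distribˡ-⊕ r (c · a) (c′ · b)) ⟩
    r · ((c · a) ⊕ (c′ · b))        ≡⟨ cong (r ·_) (trans (sym (linComb₂ c c′ a b)) (sym dx)) ⟩
    r · (d · x)                      ≡⟨ ·-assoc r d x ⟩
    (r * d) · x                      ≡⟨ cong (_· x) (ℤ.*-comm r d) ⟩
    (d * r) · x                      ≡⟨ sym (·-assoc d r x) ⟩
    d · (r · x)                      ≡⟨ cong (d ·_) rx≡sa ⟩
    d · (s · a)                      ≡⟨ ·-assoc d s a ⟩
    (d * s) · a                      ≡⟨ sym (⊕-identityʳ _) ⟩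
    ((d * s) · a) ⊕ 0v _             ≡⟨ cong (((d * s) · a) ⊕_) (sym (·-zeroˡ b)) ⟩
    ((d * s) · a) ⊕ (0ℤ · b)        ∎
  coords-unique : r * c ≡ d * s × r * c′ ≡ 0ℤ
  coords-unique = independent-coords a⊥b (r * c) (r * c′) (d * s) 0ℤ coords
  r≡0 : r ≡ 0ℤ
  r≡0 = *≡0⇒≡0 c′≢0 (proj₂ coords-unique)
  s≡0 : s ≡ 0ℤ
  s≡0 = *≡0⇒≡0 d≢0 (trans (ℤ.*-comm s d)
          (trans (sym (proj₁ coords-unique)) (cong (_* c) r≡0)))

ray : Vec ℤ m → Vec ℤ m → ℕ → Vec ℤ m
ray x e t = ((+ t) · x) ⊕ e

module _ {x e : Vec ℤ m} (x⊥e : Independent x e) where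

  ray-nonzero : ∀ t → NonZeroV (ray x e t)
  ray-nonzero t ray≡0 = 1≢0 (proj₂ (independent-coords x⊥e (+ t) 1ℤ 0ℤ 0ℤ coords))
    where
    1≢0 : ¬ 1ℤ ≡ 0ℤ
    1≢0 ()
    coords : ((+ t) · x) ⊕ (1ℤ · e) ≡ (0ℤ · x) ⊕ (0ℤ · e)
    coords = trans (cong (((+ t) · x) ⊕_) (·-identityˡ e)) (trans ray≡0 (sym (·-⊕-zero x e)))

  ray-injective : ∀ {t u} → SamePt (ray x e t) (ray x e u) → t ≡ u
  ray-injective {t} {u} (γ , δ , γ≢0 , _ , γray≡δray) with independent-coords x⊥e (γ * + t) γ (δ * + u) δ coords
    where
    scale : ∀ c t → c · ray x e t ≡ ((c * + t) · x) ⊕ (c · e)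
    scale c t = trans (·-distribˡ-⊕ c _ e) (cong (_⊕ (c · e)) (·-assoc c (+ t) x))
    coords : ((γ * + t) · x) ⊕ (γ · e) ≡ ((δ * + u) · x) ⊕ (δ · e)
    coords = trans (sym (scale γ t)) (trans γray≡δray (scale δ u))
  ... | γt≡δu , refl = ℤ.+-injective (ℤ.*-cancelˡ-≡ γ (+ t) (+ u) {{ℤ.≢-nonZero γ≢0}} γt≡δu)

ray-span₂ : ∀ {d c c′} k (x a b : Vec ℤ m) → d · x ≡ linComb (c ∷ c′ ∷ []) (a ∷ b ∷ []) →
  d · ((k · x) ⊕ a) ≡ linComb (k * c + d ∷ k * c′ ∷ []) (a ∷ b ∷ [])
ray-span₂ k []       []       []       _  = refl
ray-span₂ {d = d} {c} {c′} k (x ∷ xs) (a ∷ as) (b ∷ bs) dx with ∷-injective dx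
... | dxᵢ , dx′ = cong₂ _∷_ component (ray-span₂ k xs as bs dx′)
  where
  open ≡-Reasoning
  expand : ∀ d k x a → d * (k * x + a) ≡ k * (d * x) + d * a
  expand = solve-∀
  collect : ∀ d k c c′ a b → k * (c * a + (c′ * b + 0ℤ)) + d * a ≡ (k * c + d) * a + ((k * c′) * b + 0ℤ)
  collect = solve-∀
  component : d * (k * x + a) ≡ (k * c + d) * a + ((k * c′) * b + 0ℤ)
  component = begin
    d * (k * x + a)                    ≡⟨ expand d k x a ⟩
    k * (d * x) + d * a                ≡⟨ cong (λ z → k * z + d * a) dxᵢ ⟩
    k * (c * a + (c′ * b + 0ℤ)) + d * a ≡⟨ collect d k c c′ a b ⟩
    (k * c + d) * a + ((k * c′) * b + 0ℤ) ∎

isLine-sym : {a b : Vec ℤ m} → IsLine a b → IsLine b a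
isLine-sym (a≢0 , b≢0 , a≁b) = b≢0 , a≢0 , λ b~a → a≁b (samePt-sym b~a)

onLine-sym : {a b y : Vec ℤ m} → OnLine a b y → OnLine b a y
onLine-sym {a = a} {b} (y≢0 , d , d≢0 , (c ∷ c′ ∷ []) , dy) =
  y≢0 , d , d≢0 , (c′ ∷ c ∷ []) , trans dy (linComb₂-comm c c′ a b)

line-directionˡ : ∀ {d c c′} {a b x : Vec ℤ m} → IsLine a b → ¬ d ≡ 0ℤ → ¬ c′ ≡ 0ℤ →
  d · x ≡ linComb (c ∷ c′ ∷ []) (a ∷ b ∷ []) →
  Independent x a × (∀ t → OnLine a b (ray x a t))
line-directionˡ {d = d} {c} {c′} {a} {b} {x} ab d≢0 c′≢0 dx = x⊥a , on-line
  where
  x⊥a : Independent x a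
  x⊥a = independent-of-span₂ {c = c} (isLine⇒independent ab) d≢0 c′≢0 dx
  on-line : ∀ t → OnLine a b (ray x a t)
  on-line t = ray-nonzero x⊥a t , d , d≢0 , (+ t * c + d ∷ + t * c′ ∷ []) , ray-span₂ (+ t) x a b dx

line-direction : {a b x : Vec ℤ m} → IsLine a b → NonZeroV x → InSpan (a ∷ b ∷ []) x →
  ∃ λ e → Independent x e × (∀ t → OnLine a b (ray x e t))
line-direction {a = a} {b} ab x≢0 (d , d≢0 , (c ∷ c′ ∷ []) , dx) with c′ ℤ.≟ 0ℤ | c ℤ.≟ 0ℤ
... | no c′≢0 | _        = a , line-directionˡ {c = c} ab d≢0 c′≢0 dx
... | yes refl | no c≢0  with line-directionˡ {c = 0ℤ} (isLine-sym ab) d≢0 c≢0 (trans dx (linComb₂-comm c 0ℤ a b))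
...   | x⊥b , on-line = b , x⊥b , λ t → onLine-sym (on-line t)
line-direction {a = a} {b} ab x≢0 (d , d≢0 , (_ ∷ _ ∷ []) , dx) | yes refl | yes refl =
  ⊥-elim (x≢0 (·-cancel-0v d≢0 (trans dx (linComb-zeros (a ∷ b ∷ [])))))

-- A public copy of the private rowSq of Defs, identified with it by wedgeSq-∷.
row : ℤ → ℤ → Vec ℤ m → Vec ℤ m → ℤ
row a b []       []       = 0ℤ
row a b (x ∷ xs) (y ∷ ys) = (a * y - x * b) * (a * y - x * b) + row a b xs ys

wedgeSq-∷ : ∀ a b (xs ys : Vec ℤ m) → wedgeSq (a ∷ xs) (b ∷ ys) ≡ row a b xs ys + wedgeSq xs ys
wedgeSq-∷ a b []       []       = refl
wedgeSq-∷ a b (x ∷ xs) (y ∷ ys) =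
  cong (λ r → ((a * y - x * b) * (a * y - x * b) + r) + wedgeSq (x ∷ xs) (y ∷ ys))
       (∙-cancelʳ (wedgeSq xs ys) _ _ (wedgeSq-∷ a b xs ys))

row-shear : ∀ a b k (xs ys : Vec ℤ m) → row a (k * a + b) xs ((k · xs) ⊕ ys) ≡ row a b xs ys
row-shear a b k []       []       = refl
row-shear a b k (x ∷ xs) (y ∷ ys) = cong₂ _+_ (term a b k x y) (row-shear a b k xs ys)
  where
  term : ∀ a b k x y → (a * (k * x + y) - x * (k * a + b)) * (a * (k * x + y) - x * (k * a + b))
                      ≡ (a * y - x * b) * (a * y - x * b)
  term = solve-∀

wedgeSq-shear : ∀ k (x y : Vec ℤ m) → wedgeSq x ((k · x) ⊕ y) ≡ wedgeSq x y
wedgeSq-shear k []       []       = refl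
wedgeSq-shear k (a ∷ xs) (b ∷ ys) = begin
  wedgeSq (a ∷ xs) ((k * a + b) ∷ ((k · xs) ⊕ ys))                ≡⟨ wedgeSq-∷ a _ xs _ ⟩
  row a (k * a + b) xs ((k · xs) ⊕ ys) + wedgeSq xs ((k · xs) ⊕ ys) ≡⟨ cong₂ _+_ (row-shear a b k xs ys) (wedgeSq-shear k xs ys) ⟩
  row a b xs ys + wedgeSq xs ys                                    ≡⟨ wedgeSq-∷ a b xs ys ⟨
  wedgeSq (a ∷ xs) (b ∷ ys)                                        ∎
  where open ≡-Reasoning

coprime-1 : ∀ i → Coprime ℤ.∣ i ∣ 1
coprime-1 i = Coprime.sym (1-coprimeTo _)

ℤtoℚ-mkℚ : ∀ i → ℤtoℚ i ≡ mkℚ i 0 (coprime-1 i)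
ℤtoℚ-mkℚ i = ℚ.fromℚᵘ-toℚᵘ (mkℚ i 0 (coprime-1 i))

ℤtoℚ-homo-* : ∀ i j → ℤtoℚ (i * j) ≡ ℤtoℚ i ℚ.* ℤtoℚ j
ℤtoℚ-homo-* i j = sym (cong₂ ℚ._*_ (ℤtoℚ-mkℚ i) (ℤtoℚ-mkℚ j))

ℤtoℚ-mono-≤ : ∀ {i j} → i ℤ.≤ j → ℤtoℚ i ℚ.≤ ℤtoℚ j
ℤtoℚ-mono-≤ {i} {j} i≤j = subst₂ ℚ._≤_ (sym (ℤtoℚ-mkℚ i)) (sym (ℤtoℚ-mkℚ j))
  (ℚ.*≤* (subst₂ ℤ._≤_ (sym (ℤ.*-identityʳ i)) (sym (ℤ.*-identityʳ j)) i≤j))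

ℤtoℚ-pos : ∀ n → ℚ.0ℚ ℚ.< ℤtoℚ (+ suc n)
ℤtoℚ-pos n = subst (ℚ.0ℚ ℚ.<_) (sym (ℤtoℚ-mkℚ (+ suc n))) (ℚ.*<* (ℤ.+<+ (s≤s z≤n)))

square-nonneg : ∀ i → ∃ λ n → i * i ≡ + n
square-nonneg (+ 0)     = 0 , refl
square-nonneg +[1+ n ]  = _ , refl
square-nonneg -[1+ n ]  = _ , refl

normSq-nonneg : (x : Vec ℤ m) → ∃ λ n → normSq x ≡ + n
normSq-nonneg []       = 0 , refl
normSq-nonneg (x ∷ xs) with square-nonneg x | normSq-nonneg xs
... | a , x²≡a | b , ‖xs‖²≡b = a ℕ.+ b , cong₂ _+_ x²≡a ‖xs‖²≡b

normSq-pos : (x : Vec ℤ m) → NonZeroV x → ∃ λ n → normSq x ≡ + suc n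
normSq-pos []             x≢0 = ⊥-elim (x≢0 refl)
normSq-pos (+ 0 ∷ xs)     x≢0 with normSq-pos xs (λ xs≡0 → x≢0 (cong (0ℤ ∷_) xs≡0))
... | n , ‖xs‖²≡1+n = n , cong (_+_ 0ℤ) ‖xs‖²≡1+n
normSq-pos (+[1+ k ] ∷ xs) _  = _ , cong (_+_ (+[1+ k ] * +[1+ k ])) (proj₂ (normSq-nonneg xs))
normSq-pos (-[1+ k ] ∷ xs) _  = _ , cong (_+_ (-[1+ k ] * -[1+ k ])) (proj₂ (normSq-nonneg xs))

i≤+∣i∣ : ∀ i → i ℤ.≤ + ℤ.∣ i ∣
i≤+∣i∣ (+ n)    = ℤ.≤-refl
i≤+∣i∣ -[1+ n ] = ℤ.-≤+

-- The constant 1 + ‖x ∧ y‖² works because ‖x‖² ≥ 1 for a nonzero integer vector.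
distLe-wedgeSq : (x y : Vec ℤ m) → NonZeroV x → DistLe (ℤtoℚ (+ suc ℤ.∣ wedgeSq x y ∣)) x y
distLe-wedgeSq x y x≢0 with normSq-pos x x≢0
... | n , ‖x‖²≡1+n = subst (λ N → ℤtoℚ w ℚ.≤ (C ℚ.* C) ℚ.* ℤtoℚ N) (sym ‖x‖²≡1+n)
  (subst (ℤtoℚ w ℚ.≤_) (trans (ℤtoℚ-homo-* (c * c) (+ suc n)) (cong (ℚ._* _) (ℤtoℚ-homo-* c c)))
    (ℤtoℚ-mono-≤ (ℤ.≤-trans (i≤+∣i∣ w) (ℤ.+≤+ ∣w∣≤c²[1+n]))))
  where
  w = wedgeSq x y
  k = suc ℤ.∣ w ∣
  c = + k
  C = ℤtoℚ c
  ∣w∣≤c²[1+n] : ℤ.∣ w ∣ ≤ k ℕ.* k ℕ.* suc n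
  ∣w∣≤c²[1+n] = ℕ.≤-trans (ℕ.n≤1+n _) (ℕ.≤-trans (ℕ.m≤m*n k k) (ℕ.m≤m*n (k ℕ.* k) (suc n)))

module _ {A : Set} (R : ℕ → A → Set) (R? : ∀ t a → Dec (R t a))
         (R-functional : ∀ {t u a} → R t a → R u a → t ≡ u) where

  avoiding-index : (as : List A) (t₀ : ℕ) → ∃ λ t → t₀ ≤ t × All (λ a → ¬ R t a) as
  avoiding-index []       t₀ = t₀ , ℕ.≤-refl , []
  avoiding-index (a ∷ as) t₀ with avoiding-index as t₀
  ... | t , t₀≤t , avoid with R? t a
  ...   | no ¬Rta = t , t₀≤t , ¬Rta ∷ avoid
  ...   | yes Rta with avoiding-index as (suc t)
  ...     | t′ , t<t′ , avoid′ =
              t′ , ℕ.≤-trans t₀≤t (ℕ.<⇒≤ t<t′) , (λ Rt′a → ℕ.<-irrefl (R-functional Rta Rt′a) t<t′) ∷ avoid′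

approximants-along-ray : ∀ {m} {Z′ P : Vec ℤ m → Set} {s : Vec ℤ m → ℕ} {x e : Vec ℤ m} →
  NonZeroV x → Independent x e → (∀ t → P (ray x e t)) → (∀ y → P y → Z′ y) →
  (FL : List (Vec ℤ m)) → (∀ y → P y → s x ≤ s y → Σ (Vec ℤ m) λ f → f ∈ FL × SamePt y f) →
  Σ ℚ λ C → ℚ.0ℚ ℚ.< C ×
    ((F : List (Vec ℤ m)) → Σ (Vec ℤ m) λ y → y ∉ F × NonZeroV y × Z′ y × DistLe C x y × s y < s x)
approximants-along-ray {m} {Z′} {P} {s} {x} {e} x≢0 x⊥e ray⊆P P⊆Z′ FL FL-covers =
  C , ℤtoℚ-pos ℤ.∣ wedgeSq x e ∣ , approximant
  where
  C : ℚ
  C = ℤtoℚ (+ suc ℤ.∣ wedgeSq x e ∣)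
  approximant : (F : List (Vec ℤ m)) → Σ (Vec ℤ m) λ y → y ∉ F × NonZeroV y × Z′ y × DistLe C x y × s y < s x
  approximant F
    with avoiding-index (λ t → SamePt (ray x e t)) (λ t g → samePt? (ray x e t) g (ray-nonzero x⊥e t))
           (λ ~g ~g′ → ray-injective x⊥e (samePt-trans ~g (samePt-sym ~g′))) (F ++ FL) 0
  ... | t , _ , avoid with ++⁻ F avoid
  ...   | avoid-F , avoid-FL = ray x e t , y∉F , ray-nonzero x⊥e t , P⊆Z′ _ (ray⊆P t) , dist , s-drops
    where
    y∉F : ray x e t ∉ F
    y∉F y∈F = All.lookup avoid-F y∈F (samePt-refl (ray x e t))
    dist : DistLe C x (ray x e t)
    dist = subst (λ w → ℤtoℚ w ℚ.≤ _) (sym (wedgeSq-shear (+ t) x e)) (distLe-wedgeSq x e x≢0)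
    s-drops : s (ray x e t) < s x
    s-drops = ℕ.≰⇒> λ sx≤sy → let f , f∈FL , y~f = FL-covers _ (ray⊆P t) sx≤sy in All.lookup avoid-FL f∈FL y~f

lemma3p1 : (n : ℕ) → 2 ≤ n →
    (Z' : Pt n → Set) →
    (∀ {x y} → NonZeroV x → NonZeroV y → SamePt x y → Z' x → Z' y) →
    (∃ λ x → NonZeroV x × Z' x) →
    (k : ℕ) → k ≤ n → (Hgen : Vec (Pt n) k) →
    (s : Pt n → ℕ) →
    (∀ {x y} → NonZeroV x → NonZeroV y → SamePt x y → Z' x → s x ≡ s y) →
    (∀ x → NonZeroV x → Z' x → s x ≡ 0 → ¬ InSpan Hgen x) →
    (∀ x → NonZeroV x → Z' x → 1 ≤ s x →
      Σ (Pt n) λ a → Σ (Pt n) λ b → IsLine a b × OnLine a b x ×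
        (∀ y → OnLine a b y → Z' y) ×
        Σ (List (Pt n)) λ F → ∀ y → OnLine a b y → s x ≤ s y →
          Σ (Pt n) λ f → f ∈ F × SamePt y f) →
    (x : Pt n) → NonZeroV x → Z' x → InSpan Hgen x →
    1 ≤ s x ×
    Σ ℚ λ C → ℚ._<_ ℚ.0ℚ C ×
      ((F : List (Pt n)) → Σ (Pt n) λ y → y ∉ F × NonZeroV y × Z' y ×
         DistLe C x y × s y < s x)
lemma3p1 _ _ _ _ _ _ _ _ s _ s≡0⇒∉H line-through x x≢0 x∈Z' x∈H =
  let a , b , ab , (_ , x∈ab) , ab⊆Z' , FL , FL-covers = line-through x x≢0 x∈Z' 1≤sx
      e , x⊥e , ray⊆ab = line-direction ab x≢0 x∈ab
  in 1≤sx , approximants-along-ray x≢0 x⊥e ray⊆ab ab⊆Z' FL FL-covers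
  where
  1≤sx : 1 ≤ s x
  1≤sx = ℕ.n≢0⇒n>0 (λ sx≡0 → s≡0⇒∉H x x≢0 x∈Z' sx≡0 x∈H)
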